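{- Homotopy-initial small bipointed types are unique up to a contractible type of bipointed equivalences: the type $(\Pi A:\mathsf{Bip})(\Pi B:\mathsf{Bip})\big(\mathsf{ishinit}(A)\times\mathsf{ishinit}(B)\to\mathsf{iscontr}(\mathsf{BipEquiv}(A,B))\big)$ is inhabited.
   Context: Work in the intensional Martin-Löf type theory $\mathcal{H}$ with $\Sigma$-types, $\Pi$-types (with judgemental $\eta$), identity types, a universe $\mathsf{U}$ closed under $\Sigma,\Pi,\mathsf{Id}$, and function extensionality; no UIP. $\mathsf{iscontr}(X):=(\Sigma x:X)(\Pi y:X)\mathsf{Id}(x,y)$. $\mathsf{Bip}:=(\Sigma A:\mathsf{U})(A\times A)$, elements $(A,a_0,a_1)$. $\mathsf{Bip}(A,B):=(\Sigma f:A\to B)(\mathsf{Id}(fa_0,b_0)\times\mathsf{Id}(fa_1,b_1))$. Composite of $(f,\bar f_0,\bar f_1)$ and $(g,\bar g_0,\bar g_1)$ is $(g\circ f,\bar g_0\cdot(g\circ\bar f_0),\bar g_1\cdot(g\circ\bar f_1))$; identity is $(1_A,\mathsf{refl}(a_0),\mathsf{refl}(a_1))$. $\mathsf{isbipequiv}(f):=(\Sigma g:\mathsf{Bip}(B,A))\mathsf{Id}(gf,1_A)\times(\Sigma h:\mathsf{Bip}(B,A))\mathsf{Id}(fh,1_B)$; $\mathsf{BipEquiv}(A,B):=(\Sigma f:\mathsf{Bip}(A,B))\mathsf{isbipequiv}(f)$. $\mathsf{ishinit}(A):=(\Pi B:\mathsf{Bip})\mathsf{iscontr}(\mathsf{Bip}(A,B))$.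 -}

{-# OPTIONS --without-K #-}
module Defs where

open import Agda.Primitive using (Level; lsuc; _⊔_)
open import Data.Product using (Σ; _×_; _,_; proj₁; proj₂; Σ-syntax)
open import Relation.Binary.PropositionalEquality using (_≡_; refl; trans; cong)

-- Function extensionality (an axiom of the theory H), stated as a type
-- so that it can be assumed as a hypothesis under --safe.
FunExt : (ℓ ℓ' : Level) → Set (lsuc (ℓ ⊔ ℓ'))
FunExt ℓ ℓ' = {X : Set ℓ} {Y : X → Set ℓ'} {f g : (x : X) → Y x} →
  ((x : X) → f x ≡ g x) → f ≡ g

iscontr : ∀ {ℓ} → Set ℓ → Set ℓ
iscontr X = Σ[ x ∈ X ] ((y : X) → x ≡ y)

Bip : Set₁
Bip = Σ[ A ∈ Set ] (A × A)

∣_∣ : Bip → Set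
∣ A ∣ = proj₁ A

pt₀ : (A : Bip) → ∣ A ∣
pt₀ A = proj₁ (proj₂ A)

pt₁ : (A : Bip) → ∣ A ∣
pt₁ A = proj₂ (proj₂ A)

BipHom : Bip → Bip → Set
BipHom A B = Σ[ f ∈ (∣ A ∣ → ∣ B ∣) ] ((f (pt₀ A) ≡ pt₀ B) × (f (pt₁ A) ≡ pt₁ B))

_∘ᵇ_ : {A B C : Bip} → BipHom B C → BipHom A B → BipHom A C
(g , g₀ , g₁) ∘ᵇ (f , f₀ , f₁) =
  (λ x → g (f x)) , trans (cong g f₀) g₀ , trans (cong g f₁) g₁

idᵇ : (A : Bip) → BipHom A A
idᵇ A = (λ x → x) , refl , refl

isbipequiv : {A B : Bip} → BipHom A B → Set
isbipequiv {A} {B} f =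
  (Σ[ g ∈ BipHom B A ] (_∘ᵇ_ {A} {B} {A} g f ≡ idᵇ A)) ×
  (Σ[ h ∈ BipHom B A ] (_∘ᵇ_ {B} {A} {B} f h ≡ idᵇ B))

BipEquiv : Bip → Bip → Set
BipEquiv A B = Σ[ f ∈ BipHom A B ] isbipequiv {A} {B} f

ishinit : Bip → Set₁
ishinit A = (B : Bip) → iscontr (BipHom A B)

module Submission where

-- Contractibility is closed under Σ and under passing to path spaces.  The
-- type of equivalences is Σ over the contractible BipHom A B of two factors,
-- each a Σ over the contractible BipHom B A of a path space in a contractible
-- hom-type (BipHom A A or BipHom B B); hence it is contractible.

open import Agda.Primitive using (Level; lzero)
open import Data.Product using (_×_; Σ; _,_; proj₁; proj₂)
open import Relation.Binary.PropositionalEquality using (_≡_; refl; trans; sym; cong)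
open import Relation.Binary.PropositionalEquality.Properties using (trans-symˡ)
open import Defs

private
  variable
    a b : Level

iscontr-≡ : {X : Set a} → iscontr X → (x y : X) → iscontr (x ≡ y)
iscontr-≡ {X = X} (c , contract) x y = trans (sym (contract x)) (contract y) , unique
  where
    unique : {y : X} (p : x ≡ y) → trans (sym (contract x)) (contract y) ≡ p
    unique refl = trans-symˡ (contract x)

iscontr-Σ : {X : Set a} {P : X → Set b} →
  iscontr X → ((x : X) → iscontr (P x)) → iscontr (Σ X P)
iscontr-Σ {X = X} {P} (c , contract) contrP =
  (c , proj₁ (contrP c)) , λ (x , p) → unique (contract x) p
  where
    unique : {x : X} → c ≡ x → (p : P x) → (c , proj₁ (contrP c)) ≡ (x , p)
    unique refl p = cong (c ,_) (proj₂ (contrP c) p)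

iscontr-× : {X : Set a} {Y : Set b} → iscontr X → iscontr Y → iscontr (X × Y)
iscontr-× contrX contrY = iscontr-Σ contrX (λ _ → contrY)

proposition3p7 : FunExt lzero lzero →
    (A : Bip) → (B : Bip) → ishinit A × ishinit B → iscontr (BipEquiv A B)
proposition3p7 _ A B (initA , initB) =
  iscontr-Σ (initA B) λ _ →
    iscontr-×
      (iscontr-Σ (initB A) λ _ → iscontr-≡ (initA A) _ _)
      (iscontr-Σ (initB A) λ _ → iscontr-≡ (initB B) _ _)
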